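{- Let $n\ge2$ and $\tau_i=(c_i,d_i,p_i,J_i)$, $i=1,\dots,n$, nonnegative integers with $c_i\ge1$, $p_i\ge1$, $c_i\le d_i\le p_i$, $0\le J_i\le p_i$, $\sum_{i<n}c_i/p_i<1$. Let $I\subseteq\{1,\dots,n-1\}$, $\gamma\in\mathbb{Z}_{\ge1}$, and let $(t,x)$ be an optimal solution of \[ \min\Big\{t : t\ge\gamma+\sum_{i\in I}c_ix_i,\ p_ix_i\ge t+J_i\ \forall i\in I,\ t\in\mathbb{Z}_{\ge0},\ x\in\mathbb{Z}^I\Big\}. \] If $0<t\le p_i$ for some $i\in I$, then $x_i=1$ if $t\le p_i-J_i$ and $x_i=2$ if $t>p_i-J_i$. -}

module Defs where

open import Data.Nat as ℕ using (ℕ; zero; suc; _≤_; _∸_; _<ᵇ_)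
open import Data.Fin using (Fin; toℕ)
import Data.Fin as F
open import Data.Fin.Subset using (Subset; _∈_)
open import Data.Vec using (lookup)
open import Data.Bool using (if_then_else_)
open import Data.Integer as ℤ using (ℤ; +_)
open import Data.Rational as ℚ using (ℚ)
open import Data.Product using (_×_)

sumℤ : ∀ {n} → (Fin n → ℤ) → ℤ
sumℤ {zero} f = + 0
sumℤ {suc n} f = f F.zero ℤ.+ sumℤ (λ i → f (F.suc i))

sumℚ : ∀ {n} → (Fin n → ℚ) → ℚ
sumℚ {zero} f = ℚ.0ℚ
sumℚ {suc n} f = f F.zero ℚ.+ sumℚ (λ i → f (F.suc i))

frac : ℕ → (p : ℕ) → 1 ≤ p → ℚ
frac c p h = ℚ._/_ (+ c) p {{ℕ.>-nonZero h}}

-- Utilisation of the first n-1 tasks (0-indexed: indices 0 .. n-2)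
utilFirst : (n : ℕ) (c p : Fin n → ℕ) → (∀ i → 1 ≤ p i) → ℚ
utilFirst n c p hp =
  sumℚ (λ i → if toℕ i <ᵇ n ∸ 1 then frac (c i) (p i) (hp i) else ℚ.0ℚ)

sumI : ∀ {n} → Subset n → (Fin n → ℕ) → (Fin n → ℤ) → ℤ
sumI I c x = sumℤ (λ i → if lookup I i then (+ c i) ℤ.* x i else + 0)

-- feasibility for the integer program
--   t ≥ γ + Σ_{i∈I} c_i x_i,  p_i x_i ≥ t + J_i (i ∈ I),  t ∈ ℤ≥0, x ∈ ℤ^I
-- (x is given as a function on all of Fin n; only its values on I matter)
Feasible : ∀ {n} → (c p J : Fin n → ℕ) → Subset n → ℕ → ℕ → (Fin n → ℤ) → Set
Feasible c p J I γ t x =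
  ((+ γ) ℤ.+ sumI I c x ℤ.≤ + t)
  × (∀ i → i ∈ I → (+ t) ℤ.+ (+ J i) ℤ.≤ (+ p i) ℤ.* x i)

Optimal : ∀ {n} → (c p J : Fin n → ℕ) → Subset n → ℕ → ℕ → (Fin n → ℤ) → Set
Optimal c p J I γ t x =
  Feasible c p J I γ t x × (∀ t' x' → Feasible c p J I γ t' x' → t ≤ t')

-- Lowering x_i by one lowers Σ_{i∈I} c_i x_i by c_i ≥ 1, so (t − c_i, x − e_i) satisfies the
-- covering constraint; if it also kept p_i x_i ≥ t + J_i it would contradict the optimality of t.
-- Hence x_i is the least integer with p_i x_i ≥ t + J_i, i.e. x_i = ⌈(t + J_i) / p_i⌉, and
-- 0 < t + J_i ≤ 2 p_i leaves only the values 1 and 2, separated by the threshold t ≤ p_i − J_i.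
{-# OPTIONS --safe #-}
module Submission where

open import Defs
open import Data.Nat using (ℕ; _≤_; _<_; _∸_)
open import Data.Fin using (Fin; toℕ)
open import Data.Fin.Subset using (Subset; _∈_)
open import Data.Integer using (ℤ; +_)
open import Data.Rational using (1ℚ) renaming (_<_ to _<ℚ_)
open import Data.Product using (_×_)
open import Relation.Binary.PropositionalEquality using (_≡_)

import Data.Nat as ℕ
import Data.Nat.Properties as ℕ
open import Data.Integer using (_+_; _-_; -_; _*_; pred; +≤+; +<+)
import Data.Integer as ℤ
import Data.Integer.Properties as ℤ
import Data.Fin as Fin
import Data.Fin.Properties as Fin
open import Data.Bool using (if_then_else_)
open import Data.Vec using (lookup)
open import Data.Product using (_,_)
open import Data.Vec.Functional using (updateAt)
open import Data.Vec.Functional.Properties using (updateAt-updates; updateAt-minimal)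
open import Data.Vec.Properties using ([]=⇒lookup)
open import Data.Integer.Tactic.RingSolver using (solve-∀)
open import Function using (_∘_)
open import Relation.Nullary using (¬_; yes; no; contradiction)
open import Relation.Binary.Definitions using (tri<; tri≈; tri>)
open import Relation.Binary.PropositionalEquality
  using (_≢_; refl; sym; trans; cong; cong₂; subst; module ≡-Reasoning)

sumℤ-cong : ∀ {n} {f g : Fin n → ℤ} → (∀ j → f j ≡ g j) → sumℤ f ≡ sumℤ g
sumℤ-cong {ℕ.zero}  f≗g = refl
sumℤ-cong {ℕ.suc n} f≗g = cong₂ _+_ (f≗g Fin.zero) (sumℤ-cong (f≗g ∘ Fin.suc))

sumℤ-shiftAt : ∀ {n} (f g : Fin n → ℤ) (i : Fin n) (δ : ℤ) →
               g i ≡ f i + δ → (∀ j → j ≢ i → g j ≡ f j) → sumℤ g ≡ sumℤ f + δ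
sumℤ-shiftAt f g Fin.zero δ gᵢ g≗f = begin
  g Fin.zero + sumℤ (g ∘ Fin.suc)
    ≡⟨ cong₂ _+_ gᵢ (sumℤ-cong (λ j → g≗f (Fin.suc j) λ ())) ⟩
  (f Fin.zero + δ) + sumℤ (f ∘ Fin.suc)
    ≡⟨ exchange (f Fin.zero) δ _ ⟩
  f Fin.zero + sumℤ (f ∘ Fin.suc) + δ ∎
  where
  open ≡-Reasoning
  exchange : ∀ a b c → (a + b) + c ≡ (a + c) + b
  exchange = solve-∀
sumℤ-shiftAt f g (Fin.suc i) δ gᵢ g≗f = begin
  g Fin.zero + sumℤ (g ∘ Fin.suc)
    ≡⟨ cong₂ _+_ (g≗f Fin.zero λ ())
                 (sumℤ-shiftAt _ _ i δ gᵢ (λ j j≢i → g≗f (Fin.suc j) (j≢i ∘ Fin.suc-injective))) ⟩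
  f Fin.zero + (sumℤ (f ∘ Fin.suc) + δ)
    ≡⟨ sym (ℤ.+-assoc (f Fin.zero) _ δ) ⟩
  f Fin.zero + sumℤ (f ∘ Fin.suc) + δ ∎
  where open ≡-Reasoning

termI : ∀ {n} → Subset n → (Fin n → ℕ) → (Fin n → ℤ) → Fin n → ℤ
termI I c x j = if lookup I j then + c j * x j else + 0

sumI-pred : ∀ {n} (I : Subset n) (c : Fin n → ℕ) (x : Fin n → ℤ) {i} → i ∈ I →
            sumI I c (updateAt x i pred) ≡ sumI I c x - + c i
sumI-pred {n} I c x {i} i∈I = sumℤ-shiftAt (termI I c x) (termI I c x′) i (- + c i) at-i off-i
  where
  x′ : Fin n → ℤ
  x′ = updateAt x i pred
  *-pred : ∀ a v → a * (- ℤ.1ℤ + v) ≡ a * v - a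
  *-pred = solve-∀
  at-i : termI I c x′ i ≡ termI I c x i - + c i
  at-i rewrite []=⇒lookup i∈I | updateAt-updates i {pred} x = *-pred (+ c i) (x i)
  off-i : ∀ j → j ≢ i → termI I c x′ j ≡ termI I c x j
  off-i j j≢i rewrite updateAt-minimal j i {pred} x j≢i = refl

m-n≤m∸n : ∀ m n → + m - + n ℤ.≤ + (m ∸ n)
m-n≤m∸n m n rewrite ℤ.m-n≡m⊖n m n with n ℕ.≤? m
... | yes n≤m = ℤ.≤-reflexive (ℤ.⊖-≥ n≤m)
... | no  n≰m rewrite ℤ.⊖-≰ n≰m = ℤ.neg-≤-pos

m∸n<m : ∀ {m n} → 0 < m → 0 < n → m ∸ n < m
m∸n<m {ℕ.suc m} {ℕ.suc n} _ _ = ℕ.s≤s (ℕ.m∸n≤m m n)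

feasible-pred : ∀ {n} {c p J : Fin n → ℕ} {I γ t x i} →
                Feasible c p J I γ t x → i ∈ I → + t + + J i ℤ.≤ + p i * pred (x i) →
                Feasible c p J I γ (t ∸ c i) (updateAt x i pred)
feasible-pred {c = c} {p} {J} {I} {γ} {t} {x} {i} (cover , demand) i∈I slack = cover′ , demand′
  where
  cover′ : + γ + sumI I c (updateAt x i pred) ℤ.≤ + (t ∸ c i)
  cover′ = begin
    + γ + sumI I c (updateAt x i pred) ≡⟨ cong (_+_ (+ γ)) (sumI-pred I c x i∈I) ⟩
    + γ + (sumI I c x - + c i)         ≡⟨ sym (ℤ.+-assoc (+ γ) (sumI I c x) (- + c i)) ⟩
    + γ + sumI I c x - + c i           ≤⟨ ℤ.+-monoˡ-≤ (- + c i) cover ⟩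
    + t - + c i                        ≤⟨ m-n≤m∸n t (c i) ⟩
    + (t ∸ c i)                        ∎
    where open ℤ.≤-Reasoning
  lower-t : ∀ a → + (t ∸ c i) + + a ℤ.≤ + t + + a
  lower-t a = +≤+ (ℕ.+-monoˡ-≤ a (ℕ.m∸n≤m t (c i)))
  demand′ : ∀ j → j ∈ I → + (t ∸ c i) + + J j ℤ.≤ + p j * updateAt x i pred j
  demand′ j j∈I with j Fin.≟ i
  ... | yes refl rewrite updateAt-updates i {pred} x = ℤ.≤-trans (lower-t (J i)) slack
  ... | no  j≢i  rewrite updateAt-minimal j i {pred} x j≢i = ℤ.≤-trans (lower-t (J j)) (demand j j∈I)

optimal⇒p*pred[x]<t+J : ∀ {n} {c p J : Fin n → ℕ} {I γ t x i} →
                        Optimal c p J I γ t x → i ∈ I → 0 < c i → 0 < t →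
                        + p i * pred (x i) ℤ.< + t + + J i
optimal⇒p*pred[x]<t+J {c = c} {p} {J} {I} {γ} {t} {x} {i} (feasible , minimal) i∈I cᵢ>0 t>0 =
  ℤ.≰⇒> pred-infeasible
  where
  pred-infeasible : ¬ (+ t + + J i ℤ.≤ + p i * pred (x i))
  pred-infeasible slack = ℕ.<⇒≱ (m∸n<m t>0 cᵢ>0)
    (minimal (t ∸ c i) (updateAt x i pred) (feasible-pred {c = c} {p} {J} feasible i∈I slack))

record IsCeilDiv (a : ℤ) (p : ℕ) (v : ℤ) : Set where
  constructor isCeilDiv
  field
    upper   : a ℤ.≤ + p * v
    minimal : + p * pred v ℤ.< a

isCeilDiv-≮ : ∀ {a p v w} → IsCeilDiv a p v → IsCeilDiv a p w → ¬ v ℤ.< w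
isCeilDiv-≮ {p = p} {v} {w} (isCeilDiv a≤p*v _) (isCeilDiv _ p*pred[w]<a) v<w =
  ℤ.<-irrefl refl (ℤ.≤-<-trans (ℤ.≤-trans a≤p*v p*v≤p*pred[w]) p*pred[w]<a)
  where
  p*v≤p*pred[w] : + p * v ℤ.≤ + p * pred w
  p*v≤p*pred[w] = ℤ.*-monoˡ-≤-nonNeg (+ p) (ℤ.i<j⇒i≤pred[j] v<w)

isCeilDiv-unique : ∀ {a p v w} → IsCeilDiv a p v → IsCeilDiv a p w → v ≡ w
isCeilDiv-unique {v = v} {w} v-ceil w-ceil with ℤ.<-cmp v w
... | tri< v<w _ _ = contradiction v<w (isCeilDiv-≮ v-ceil w-ceil)
... | tri≈ _ v≡w _ = v≡w
... | tri> _ _ w<v = contradiction w<v (isCeilDiv-≮ w-ceil v-ceil)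

isCeilDiv-suc : ∀ {a p k} → p ℕ.* k < a → a ≤ p ℕ.* ℕ.suc k → IsCeilDiv (+ a) p (+ ℕ.suc k)
isCeilDiv-suc {a} {p} {k} p*k<a a≤p*[1+k] =
  isCeilDiv (subst (+ a ℤ.≤_) (ℤ.pos-* p (ℕ.suc k)) (+≤+ a≤p*[1+k]))
            (subst (ℤ._< + a) (trans (ℤ.pos-* p k) (cong (+ p *_) (sym (ℤ.pred-suc (+ k))))) (+<+ p*k<a))

isCeilDiv-1 : ∀ {a p} → 0 < a → a ≤ p → IsCeilDiv (+ a) p (+ 1)
isCeilDiv-1 {a} {p} a>0 a≤p =
  isCeilDiv-suc {k = 0} (subst (_< a) (sym (ℕ.*-zeroʳ p)) a>0) (subst (a ≤_) (sym (ℕ.*-identityʳ p)) a≤p)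

isCeilDiv-2 : ∀ {a p} → p < a → a ≤ p ℕ.+ p → IsCeilDiv (+ a) p (+ 2)
isCeilDiv-2 {a} {p} p<a a≤p+p =
  isCeilDiv-suc {k = 1} (subst (_< a) (sym (ℕ.*-identityʳ p)) p<a) (subst (a ≤_) p+p≡p*2 a≤p+p)
  where
  p+p≡p*2 : p ℕ.+ p ≡ p ℕ.* 2
  p+p≡p*2 = sym (trans (ℕ.*-suc p 1) (cong (p ℕ.+_) (ℕ.*-identityʳ p)))

lemma13 : (n : ℕ) → 2 ≤ n
    → (c d p J : Fin n → ℕ)
    → (∀ i → 1 ≤ c i)
    → (hp : ∀ i → 1 ≤ p i)
    → (∀ i → c i ≤ d i)
    → (∀ i → d i ≤ p i)
    → (∀ i → J i ≤ p i)
    → utilFirst n c p hp <ℚ 1ℚ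
    → (I : Subset n) → (∀ i → i ∈ I → toℕ i < n ∸ 1)
    → (γ : ℕ) → 1 ≤ γ
    → (t : ℕ) (x : Fin n → ℤ) → Optimal c p J I γ t x
    → (i : Fin n) → i ∈ I → 0 < t → t ≤ p i
    → (t ≤ p i ∸ J i → x i ≡ + 1) × (p i ∸ J i < t → x i ≡ + 2)
lemma13 _ _ c _ p J c>0 _ _ _ J≤p _ _ _ _ _ t x optimal@((_ , demand) , _) i i∈I t>0 t≤pᵢ =
  (λ t≤pᵢ∸Jᵢ → isCeilDiv-unique xᵢ-ceil (isCeilDiv-1 t+Jᵢ>0 (ℕ.m≤o∸n⇒m+n≤o t (J≤p i) t≤pᵢ∸Jᵢ))) ,
  (λ pᵢ∸Jᵢ<t → isCeilDiv-unique xᵢ-ceil (isCeilDiv-2 (pᵢ<t+Jᵢ pᵢ∸Jᵢ<t) (ℕ.+-mono-≤ t≤pᵢ (J≤p i))))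
  where
  xᵢ-ceil : IsCeilDiv (+ (t ℕ.+ J i)) (p i) (x i)
  xᵢ-ceil = isCeilDiv (demand i i∈I) (optimal⇒p*pred[x]<t+J {c = c} {p} {J} optimal i∈I (c>0 i) t>0)
  t+Jᵢ>0 : 0 < t ℕ.+ J i
  t+Jᵢ>0 = ℕ.<-≤-trans t>0 (ℕ.m≤m+n t (J i))
  pᵢ<t+Jᵢ : p i ∸ J i < t → p i < t ℕ.+ J i
  pᵢ<t+Jᵢ pᵢ∸Jᵢ<t = ℕ.≰⇒> (ℕ.<⇒≱ pᵢ∸Jᵢ<t ∘ ℕ.m+n≤o⇒m≤o∸n t)
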